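{- For every interpretation $(\mathcal{M},\gamma)$ there is a unique prime theory $\Phi_p\subseteq Fm_0$ of intuitionistic propositional logic such that for all $\varphi\in Fm_0$: $(\mathcal{M},\gamma)\vDash\square\varphi\iff\varphi\in\Phi_p$.
   Context: $Fm$ is the set of formulas generated from an infinite set $V$ of propositional variables by $\bot$, binary $\rightarrow,\vee,\wedge$ and unary $\square$; $Fm_0$ is the set of formulas without $\square$. A prime theory of IPC is a set $\Phi_p\subseteq Fm_0$ that is consistent in intuitionistic propositional logic ($\bot$ not derivable), closed under intuitionistic derivability, and such that $\varphi\vee\psi\in\Phi_p$ implies $\varphi\in\Phi_p$ or $\psi\in\Phi_p$. Semantics: a Heyting algebra $(M,f_\top,f_\bot,f_\vee,f_\wedge,f_\rightarrow)$ is a bounded lattice (top $f_\top$, bottom $f_\bot$, order $\le$) with $f_\rightarrow(m,m')$ the greatest $m''$ with $f_\wedge(m,m'')\le m'$; a filter is a non-empty upward closed $F\subseteq M$ closed under $f_\wedge$ with $f_\bot\notin F$; an ultrafilter is a maximal filter. A model $\mathcal{M}=(M,\mathit{TRUE},f_\top,f_\bot,f_\rightarrow,f_\vee,f_\wedge,f_\square)$ is a Heyting algebra with an ultrafilter $\mathit{TRUE}$ and unary $f_\square$ such that for all $m,m',m''$: (1) $f_\square(m)\le m$; (2) $f_\square(f_\rightarrow(m,m'))\le f_\rightarrow(f_\square(f_\rightarrow(m',m'')),f_\square(f_\rightarrow(m,m'')))$; (3) $f_\square(f_\vee(m,m'))\le f_\vee(f_\square(m),f_\square(m'))$; (4) $f_\square(m)\in\mathit{TRUE}\iff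 m=f_\top$. An assignment $\gamma:V\to M$ extends homomorphically to $Fm$ ($\gamma(\bot)=f_\bot$, $\gamma(\square\varphi)=f_\square(\gamma(\varphi))$, $\gamma(\varphi*\psi)=f_*(\gamma(\varphi),\gamma(\psi))$). An interpretation is a pair $(\mathcal{M},\gamma)$; $(\mathcal{M},\gamma)\vDash\varphi$ iff $\gamma(\varphi)\in\mathit{TRUE}$. -}

module Defs where

open import Level using (0ℓ)
open import Data.Nat using (ℕ)
open import Data.Product using (Σ; _×_; ∃)
open import Data.Sum using (_⊎_)
open import Relation.Nullary using (¬_)
open import Function.Bundles using (_⇔_)
open import Relation.Binary.Lattice.Bundles using (HeytingAlgebra)

Var : Set
Var = ℕ

data Fm : Set where
  var  : Var → Fm
  ⊥'   : Fm
  _⇒_  : Fm → Fm → Fm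
  _∨'_ : Fm → Fm → Fm
  _∧'_ : Fm → Fm → Fm
  □_   : Fm → Fm

data Fm₀ : Set where
  var  : Var → Fm₀
  ⊥'   : Fm₀
  _⇒_  : Fm₀ → Fm₀ → Fm₀
  _∨'_ : Fm₀ → Fm₀ → Fm₀
  _∧'_ : Fm₀ → Fm₀ → Fm₀

⌜_⌝ : Fm₀ → Fm
⌜ var x ⌝    = var x
⌜ ⊥' ⌝       = ⊥'
⌜ φ ⇒ ψ ⌝    = ⌜ φ ⌝ ⇒ ⌜ ψ ⌝
⌜ φ ∨' ψ ⌝   = ⌜ φ ⌝ ∨' ⌜ ψ ⌝
⌜ φ ∧' ψ ⌝   = ⌜ φ ⌝ ∧' ⌜ ψ ⌝

data _⊢_ (Γ : Fm₀ → Set) : Fm₀ → Set where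
  hyp : ∀ {φ} → Γ φ → Γ ⊢ φ
  ax1 : ∀ {φ ψ} → Γ ⊢ (φ ⇒ (ψ ⇒ φ))
  ax2 : ∀ {φ ψ χ} → Γ ⊢ ((φ ⇒ (ψ ⇒ χ)) ⇒ ((φ ⇒ ψ) ⇒ (φ ⇒ χ)))
  ax3 : ∀ {φ ψ} → Γ ⊢ ((φ ∧' ψ) ⇒ φ)
  ax4 : ∀ {φ ψ} → Γ ⊢ ((φ ∧' ψ) ⇒ ψ)
  ax5 : ∀ {φ ψ} → Γ ⊢ (φ ⇒ (ψ ⇒ (φ ∧' ψ)))
  ax6 : ∀ {φ ψ} → Γ ⊢ (φ ⇒ (φ ∨' ψ))
  ax7 : ∀ {φ ψ} → Γ ⊢ (ψ ⇒ (φ ∨' ψ))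
  ax8 : ∀ {φ ψ χ} → Γ ⊢ ((φ ⇒ χ) ⇒ ((ψ ⇒ χ) ⇒ ((φ ∨' ψ) ⇒ χ)))
  ax9 : ∀ {φ} → Γ ⊢ (⊥' ⇒ φ)
  mp  : ∀ {φ ψ} → Γ ⊢ (φ ⇒ ψ) → Γ ⊢ φ → Γ ⊢ ψ

record PrimeTheory (Φ : Fm₀ → Set) : Set₁ where
  field
    consistent : ¬ (Φ ⊢ ⊥')
    closed     : ∀ φ → Φ ⊢ φ → Φ φ
    prime      : ∀ φ ψ → Φ (φ ∨' ψ) → Φ φ ⊎ Φ ψ

-- The carrier equality is the setoid equality _≈_.

module _ (H : HeytingAlgebra 0ℓ 0ℓ 0ℓ) where
  open HeytingAlgebra H

  record IsFilter (F : Carrier → Set) : Set where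
    field
      nonempty : ∃ F
      upward   : ∀ {m m'} → F m → m ≤ m' → F m'
      meet     : ∀ {m m'} → F m → F m' → F (m ∧ m')
      proper   : ¬ F ⊥

  record IsUltrafilter (U : Carrier → Set) : Set₁ where
    field
      isFilter : IsFilter U
      maximal  : ∀ (G : Carrier → Set) → IsFilter G →
                 (∀ m → U m → G m) → ∀ m → G m → U m

record Model : Set₁ where
  field
    heyting : HeytingAlgebra 0ℓ 0ℓ 0ℓ
  open HeytingAlgebra heyting
  field
    TRUE   : Carrier → Set
    f□     : Carrier → Carrier
    isUltrafilter : IsUltrafilter heyting TRUE
    -- f□ is a function on the underlying set (respects the carrier equality)
    f□-cong : ∀ {m m'} → m ≈ m' → f□ m ≈ f□ m'
    ax-T   : ∀ m → f□ m ≤ m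
    ax-K   : ∀ m m' m'' → f□ (m ⇨ m') ≤ (f□ (m' ⇨ m'') ⇨ f□ (m ⇨ m''))
    ax-∨   : ∀ m m' → f□ (m ∨ m') ≤ (f□ m ∨ f□ m')
    ax-TRUE : ∀ m → TRUE (f□ m) ⇔ (m ≈ ⊤)

record Interpretation : Set₁ where
  field
    model : Model
  open Model model public
  open HeytingAlgebra heyting public
  field
    γ : Var → Carrier

  ⟦_⟧ : Fm → Carrier
  ⟦ var x ⟧  = γ x
  ⟦ ⊥' ⟧     = ⊥
  ⟦ φ ⇒ ψ ⟧  = ⟦ φ ⟧ ⇨ ⟦ ψ ⟧
  ⟦ φ ∨' ψ ⟧ = ⟦ φ ⟧ ∨ ⟦ ψ ⟧
  ⟦ φ ∧' ψ ⟧ = ⟦ φ ⟧ ∧ ⟦ ψ ⟧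
  ⟦ □ φ ⟧    = f□ ⟦ φ ⟧

_⊨_ : Interpretation → Fm → Set
I ⊨ φ = Interpretation.TRUE I (Interpretation.⟦_⟧ I φ)

-- By axiom (4), I ⊨ □φ holds exactly when γ(φ) is the top element, so the
-- set of φ ∈ Fm₀ with I ⊨ □φ is the set of formulas valid under γ: it is
-- deductively closed by soundness of IPC for Heyting algebras, and
-- consistent since ⊥ ∉ TRUE.  Primeness comes from axiom (3),
-- f□(a ∨ b) ≤ f□ a ∨ f□ b, and primeness of ultrafilters: if neither x nor y
-- were in TRUE, maximality would put ⊥ into the filters generated by
-- TRUE ∪ {x} and TRUE ∪ {y}, and distributivity then puts ⊥ into TRUE.
-- This only refutes ¬(x ∈ TRUE ⊎ y ∈ TRUE); excluded middle removes the
-- double negation.  Uniqueness is immediate, since the defining equivalence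
-- determines Φ pointwise.
module Submission where

open import Defs
open import Level using (0ℓ)
open import Data.Product using (Σ; _×_; _,_; proj₂; ∃)
open import Data.Sum using (_⊎_; inj₁; inj₂)
open import Relation.Nullary using (¬_)
open import Relation.Nullary.Decidable using (decidable-stable)
open import Function.Base using (_∘_)
open import Function.Bundles using (_⇔_; mk⇔; Equivalence)
open import Function.Construct.Identity using (⇔-id)
open import Function.Construct.Symmetry using (⇔-sym)
open import Axiom.ExcludedMiddle using (ExcludedMiddle)
open import Relation.Binary.Lattice.Bundles using (HeytingAlgebra)
import Relation.Binary.Lattice.Properties.HeytingAlgebra as HeytingProperties
import Relation.Binary.Lattice.Properties.MeetSemilattice as MeetProperties

module ImplicationLemmas {c ℓ₁ ℓ₂} (H : HeytingAlgebra c ℓ₁ ℓ₂) where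
  open HeytingAlgebra H
  open HeytingProperties H using (⇨-eval; swap-transpose-⇨)
  open MeetProperties meetSemilattice using (∧-monotonic)

  ⊤≤⇨ : ∀ {x y} → x ≤ y → ⊤ ≤ x ⇨ y
  ⊤≤⇨ {x} x≤y = swap-transpose-⇨ (trans (x∧y≤x x ⊤) x≤y)

  ⊤≤-modusPonens : ∀ {x y} → ⊤ ≤ x ⇨ y → ⊤ ≤ x → ⊤ ≤ y
  ⊤≤-modusPonens ⊤≤x⇨y ⊤≤x = trans (∧-greatest ⊤≤x⇨y ⊤≤x) ⇨-eval

  ⇨-distribˡ-⇨ : ∀ x y z → x ⇨ (y ⇨ z) ≤ (x ⇨ y) ⇨ (x ⇨ z)
  ⇨-distribˡ-⇨ x y z = transpose-⇨ (transpose-⇨ (trans (∧-greatest w≤y⇨z w≤y) ⇨-eval))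
    where
    w : Carrier
    w = ((x ⇨ (y ⇨ z)) ∧ (x ⇨ y)) ∧ x

    w≤y⇨z : w ≤ y ⇨ z
    w≤y⇨z = trans (∧-monotonic (x∧y≤x _ _) refl) ⇨-eval

    w≤y : w ≤ y
    w≤y = trans (∧-monotonic (x∧y≤y _ _) refl) ⇨-eval

module FilterLemmas (H : HeytingAlgebra 0ℓ 0ℓ 0ℓ)
                    {F : HeytingAlgebra.Carrier H → Set} (isFilter : IsFilter H F) where
  open HeytingAlgebra H
  open IsFilter isFilter

  ⊤∈F : F ⊤
  ⊤∈F = upward (proj₂ nonempty) (maximum _)

  ⊤≤x⇒x∈F : ∀ {x} → ⊤ ≤ x → F x
  ⊤≤x⇒x∈F = upward ⊤∈F

module UltrafilterLemmas (H : HeytingAlgebra 0ℓ 0ℓ 0ℓ)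
                         {U : HeytingAlgebra.Carrier H → Set} (isUltrafilter : IsUltrafilter H U) where
  open HeytingAlgebra H
  open HeytingProperties H using (∧-distribˡ-∨-≤)
  open MeetProperties meetSemilattice using (∧-monotonic)
  open IsUltrafilter isUltrafilter
  open IsFilter isFilter
  open FilterLemmas H isFilter using (⊤∈F)

  -- The filter generated by U ∪ {x}; it may contain ⊥.
  Extension : Carrier → Carrier → Set
  Extension x m = ∃ λ u → U u × u ∧ x ≤ m

  extension-isFilter : ∀ {x} → ¬ Extension x ⊥ → IsFilter H (Extension x)
  extension-isFilter {x} ⊥∉ = record
    { nonempty = x , ⊤ , ⊤∈F , x∧y≤y ⊤ x
    ; upward   = λ { (u , u∈U , u∧x≤m) m≤m' → u , u∈U , trans u∧x≤m m≤m' }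
    ; meet     = λ { (u , u∈U , u∧x≤m) (u' , u'∈U , u'∧x≤m') →
        u ∧ u' , meet u∈U u'∈U ,
        ∧-greatest (trans (∧-monotonic (x∧y≤x u u') refl) u∧x≤m)
                   (trans (∧-monotonic (x∧y≤y u u') refl) u'∧x≤m') }
    ; proper   = ⊥∉
    }

  proper-extension⇒∈ : ∀ {x} → ¬ Extension x ⊥ → U x
  proper-extension⇒∈ {x} ⊥∉ =
    maximal (Extension x) (extension-isFilter ⊥∉)
            (λ u u∈U → u , u∈U , x∧y≤x u x) x (⊤ , ⊤∈F , x∧y≤y ⊤ x)

  not-both-extensions-improper : ∀ {x y} → U (x ∨ y) → ¬ (Extension x ⊥ × Extension y ⊥)
  not-both-extensions-improper {x} {y} x∨y∈U ((u , u∈U , u∧x≤⊥) , (u' , u'∈U , u'∧y≤⊥)) =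
    proper (upward (meet (meet u∈U u'∈U) x∨y∈U)
      (trans (∧-distribˡ-∨-≤ (u ∧ u') x y)
        (∨-least (trans (∧-monotonic (x∧y≤x u u') refl) u∧x≤⊥)
                 (trans (∧-monotonic (x∧y≤y u u') refl) u'∧y≤⊥))))

  ultrafilter-¬¬prime : ∀ {x y} → U (x ∨ y) → ¬ ¬ (U x ⊎ U y)
  ultrafilter-¬¬prime {x} {y} x∨y∈U x∉U⊎y∉U =
    x∉U (proper-extension⇒∈ λ ext-x →
      y∉U (proper-extension⇒∈ λ ext-y →
        not-both-extensions-improper x∨y∈U (ext-x , ext-y)))
    where
    x∉U : ¬ U x
    x∉U = x∉U⊎y∉U ∘ inj₁

    y∉U : ¬ U y
    y∉U = x∉U⊎y∉U ∘ inj₂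

  ultrafilter-prime : ExcludedMiddle 0ℓ → ∀ {x y} → U (x ∨ y) → U x ⊎ U y
  ultrafilter-prime em x∨y∈U = decidable-stable em (ultrafilter-¬¬prime x∨y∈U)

module Soundness (I : Interpretation) where
  open Interpretation I
  open ImplicationLemmas heyting
  open HeytingProperties heyting using (y≤x⇨y; ⇨-distribˡ-∨-∧-≥)

  Valid : Fm₀ → Set
  Valid φ = ⊤ ≤ ⟦ ⌜ φ ⌝ ⟧

  sound : ∀ {Γ φ} → (∀ {ψ} → Γ ψ → Valid ψ) → Γ ⊢ φ → Valid φ
  sound Γ-valid (hyp ψ∈Γ) = Γ-valid ψ∈Γ
  sound _       ax1       = ⊤≤⇨ y≤x⇨y
  sound _       ax2       = ⊤≤⇨ (⇨-distribˡ-⇨ _ _ _)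
  sound _       ax3       = ⊤≤⇨ (x∧y≤x _ _)
  sound _       ax4       = ⊤≤⇨ (x∧y≤y _ _)
  sound _       ax5       = ⊤≤⇨ (transpose-⇨ refl)
  sound _       ax6       = ⊤≤⇨ (x≤x∨y _ _)
  sound _       ax7       = ⊤≤⇨ (y≤x∨y _ _)
  sound _       ax8       = ⊤≤⇨ (transpose-⇨ (⇨-distribˡ-∨-∧-≥ _ _ _))
  sound _       ax9       = ⊤≤⇨ (minimum _)
  sound Γ-valid (mp d e)  = ⊤≤-modusPonens (sound Γ-valid d) (sound Γ-valid e)

module BoxedTheory (I : Interpretation) where
  open Interpretation I
  open IsUltrafilter isUltrafilter using (isFilter)
  open IsFilter isFilter using (upward; proper)
  open FilterLemmas heyting isFilter using (⊤≤x⇒x∈F)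
  open UltrafilterLemmas heyting isUltrafilter using (ultrafilter-prime)
  open Soundness I

  Boxed : Fm₀ → Set
  Boxed φ = I ⊨ (□ ⌜ φ ⌝)

  boxed⇔valid : ∀ φ → Boxed φ ⇔ Valid φ
  boxed⇔valid φ = mk⇔ (λ □φ → reflexive (Eq.sym (Equivalence.to (ax-TRUE _) □φ)))
                        (λ ⊤≤φ → Equivalence.from (ax-TRUE _) (antisym (maximum _) ⊤≤φ))

  derivable⇒valid : ∀ {φ} → Boxed ⊢ φ → Valid φ
  derivable⇒valid = sound (λ {ψ} → Equivalence.to (boxed⇔valid ψ))

  boxed-isPrimeTheory : ExcludedMiddle 0ℓ → PrimeTheory Boxed
  boxed-isPrimeTheory em = record
    { consistent = λ ⊢⊥ → proper (⊤≤x⇒x∈F (derivable⇒valid ⊢⊥))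
    ; closed     = λ φ ⊢φ → Equivalence.from (boxed⇔valid φ) (derivable⇒valid ⊢φ)
    ; prime      = λ φ ψ □φ∨ψ → ultrafilter-prime em (upward □φ∨ψ (ax-∨ _ _))
    }

proposition5p3 : ExcludedMiddle 0ℓ → (I : Interpretation) →
    Σ (Fm₀ → Set) λ Φ →
    (PrimeTheory Φ × (∀ φ → (I ⊨ (□ ⌜ φ ⌝)) ⇔ Φ φ)) ×
    (∀ (Ψ : Fm₀ → Set) → PrimeTheory Ψ → (∀ φ → (I ⊨ (□ ⌜ φ ⌝)) ⇔ Ψ φ) →
    ∀ φ → Ψ φ ⇔ Φ φ)
proposition5p3 em I =
  Boxed , (boxed-isPrimeTheory em , λ φ → ⇔-id (Boxed φ)) , λ _ _ □⇔Ψ φ → ⇔-sym (□⇔Ψ φ)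
  where open BoxedTheory I
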